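{- For every $n \geq 30$, every graph $G$ on $n$ vertices with $\delta(G) \geq \lfloor n/2 \rfloor + 1$ satisfies $m(G, 3) = 3$.
   Context: Graphs are finite and simple; $\delta(G)$ is the minimum degree and $N(v)$ the neighbourhood of $v$. For an integer $r \geq 2$, the $r$-neighbour bootstrap process on $G$ started from $A \subseteq V(G)$ is defined by $A_0 = A$ and $A_t = A_{t-1} \cup \{v \in V(G) : |N(v) \cap A_{t-1}| \geq r\}$ for $t \geq 1$. The closure is $\langle A \rangle_r = \bigcup_{t \geq 0} A_t$. The set $A$ percolates if $\langle A \rangle_r = V(G)$. Define $m(G,r) = \min\{|A| : A \subseteq V(G),\ \langle A \rangle_r = V(G)\}$. -}

module Defs where

open import Data.Nat using (ℕ; zero; suc; _+_; _≤_; _≤ᵇ_; _/_)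
open import Data.Bool using (Bool; true; false; _∧_; _∨_; if_then_else_)
open import Data.Fin using (Fin)
open import Data.Product using (Σ; _×_; ∃; ∃-syntax)
open import Relation.Binary.PropositionalEquality using (_≡_)

count : ∀ {n} → (Fin n → Bool) → ℕ
count {zero}  p = 0
count {suc n} p = (if p Fin.zero then 1 else 0) + count {n} (λ i → p (Fin.suc i))

record Graph (n : ℕ) : Set where
  field
    adj   : Fin n → Fin n → Bool
    sym   : ∀ u v → adj u v ≡ adj v u
    irrefl : ∀ v → adj v v ≡ false
open Graph public

VSet : ℕ → Set
VSet n = Fin n → Bool

∣_∣ : ∀ {n} → VSet n → ℕ
∣ A ∣ = count A

degree : ∀ {n} → Graph n → Fin n → ℕ
degree G v = count (adj G v)

minDegree≥ : ∀ {n} → Graph n → ℕ → Set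
minDegree≥ G d = ∀ v → d ≤ degree G v

step : ∀ {n} → Graph n → ℕ → VSet n → VSet n
step G r A v = A v ∨ (r ≤ᵇ count (λ u → adj G v u ∧ A u))

bootstrap : ∀ {n} → Graph n → ℕ → VSet n → ℕ → VSet n
bootstrap G r A zero    = A
bootstrap G r A (suc t) = step G r (bootstrap G r A t)

InClosure : ∀ {n} → Graph n → ℕ → VSet n → Fin n → Set
InClosure G r A v = ∃[ t ] bootstrap G r A t v ≡ true

Percolates : ∀ {n} → Graph n → ℕ → VSet n → Set
Percolates G r A = ∀ v → InClosure G r A v

m≡ : ∀ {n} → Graph n → ℕ → ℕ → Set
m≡ G r k = (Σ (VSet _) λ A → ∣ A ∣ ≡ k × Percolates G r A)
         × (∀ A → Percolates G r A → k ≤ ∣ A ∣)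

-- Sets of fewer than three vertices are closed under the 3-neighbour process, so m(G,3) ≥ 3.
-- If G is complete, any three vertices percolate.  Otherwise let k = ⌊n/2⌋ and pick a non-adjacent
-- pair x, y with the fewest common neighbours (at least 3, as deg x + deg y ≥ 2k + 2 > n − 2); start
-- from three of them, so that x and y are infected at once.  Suppose the final closed set S misses a
-- vertex, and let s = |S|, t = n − s.  A vertex outside S has at most 2 neighbours in S, so at most 2t
-- edges leave S, and t ≥ k.  Summing degrees (≥ k + 1) over S, and bounding the edges inside S by the
-- X non-neighbours of x and y in S, gives s(k + 1) + 2X + s ≤ 2t + s² + 2; also s ≤ c + X for the number
-- c of common neighbours of x and y, and if c ≥ 5 then by minimality of the pair every vertex of S has
-- at least 3 neighbours outside S, so 3s ≤ 2t.  Together with s + t ≤ 2k + 1 and k ≥ 15 this is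
-- impossible.

module Submission where

open import Defs hiding (sym)
open import Data.Bool using (Bool; true; false; _∧_; _∨_; not; if_then_else_)
open import Data.Bool.Properties
  using (∧-comm; ∧-conicalˡ; ∧-conicalʳ; ∧-identityʳ; ∧-zeroʳ; ∨-zeroʳ; not-injective; T-≡) renaming (_≟_ to _≟ᴮ_)
open import Data.Fin using (Fin; zero; suc; _≟_)
open import Data.Fin.Properties using (any?)
open import Data.List using (List; []; _∷_; length)
open import Data.List.Relation.Unary.All as All using (All; []; _∷_)
open import Data.List.Relation.Unary.AllPairs using (AllPairs; []; _∷_)
open import Data.Nat
  using (ℕ; zero; suc; _+_; _*_; _/_; _%_; _≤_; _<_; _≤?_; _<?_; _≤ᵇ_; z≤n; s≤s; s≤s⁻¹)
open import Data.Nat.DivMod using (m≡m%n+[m/n]*n; m%n<n; /-monoˡ-≤)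
open import Data.Nat.Properties hiding (_≟_)
open import Data.Nat.Tactic.RingSolver using (solve; solve-∀)
open import Algebra.Properties.CommutativeMonoid.Sum +-0-commutativeMonoid using (sum; sum-cong-≗)
open import Algebra.Properties.CommutativeSemigroup +-commutativeSemigroup using (interchange)
open import Data.Empty using (⊥; ⊥-elim)
open import Data.Product using (∃; ∃-syntax; _×_; _,_; proj₁; proj₂; uncurry)
open import Data.Sum as Sum using (_⊎_; inj₁; inj₂)
open import Function using (_∘_; _∋_; flip)
open import Function.Bundles using (Equivalence)
open import Relation.Binary.PropositionalEquality
open import Relation.Nullary using (¬_; Dec; does; yes; no; contradiction)
open import Relation.Nullary.Decidable using (dec-true; dec-false; map′; ¬?; _×-dec_; toSum)

-- Finite sets of vertices

𝟙 : Bool → ℕ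
𝟙 b = if b then 1 else 0

module _ {n : ℕ} where

  infix  4 _∈_ _∉_ _⊆_
  infixr 7 _∩_
  infixr 6 _∪_

  _∈_ _∉_ : Fin n → VSet n → Set
  i ∈ A = A i ≡ true
  i ∉ A = A i ≡ false

  _⊆_ : VSet n → VSet n → Set
  A ⊆ B = ∀ i → i ∈ A → i ∈ B

  _∩_ _∪_ : VSet n → VSet n → VSet n
  (A ∩ B) i = A i ∧ B i
  (A ∪ B) i = A i ∨ B i

  ∁ : VSet n → VSet n
  ∁ A i = not (A i)

  ∅ full : VSet n
  ∅    _ = false
  full _ = true

  ｛_｝ : Fin n → VSet n
  ｛ i ｝ j = does (j ≟ i)

  ∑∈ : VSet n → (Fin n → ℕ) → ℕ
  ∑∈ A f = sum (λ u → 𝟙 (A u) * f u)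

  syntax ∑∈ A (λ u → e) = ∑[ u ∈ A ] e

sum-mono : ∀ {n} {f g : Fin n → ℕ} → (∀ i → f i ≤ g i) → sum f ≤ sum g
sum-mono {zero}  f≤g = z≤n
sum-mono {suc n} f≤g = +-mono-≤ (f≤g zero) (sum-mono (f≤g ∘ suc))

sum-distrib-+ : ∀ {n} (f g : Fin n → ℕ) → sum (λ i → f i + g i) ≡ sum f + sum g
sum-distrib-+ {zero}  f g = refl
sum-distrib-+ {suc n} f g = trans (cong (f zero + g zero +_) (sum-distrib-+ (f ∘ suc) (g ∘ suc)))
                                  (interchange (f zero) (g zero) (sum (f ∘ suc)) (sum (g ∘ suc)))

sum-distrib-+₃ : ∀ {n} (f g h : Fin n → ℕ) → sum (λ i → f i + g i + h i) ≡ sum f + sum g + sum h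
sum-distrib-+₃ f g h = trans (sum-distrib-+ (λ i → f i + g i) h) (cong (_+ sum h) (sum-distrib-+ f g))

sum-distrib-+₄ : ∀ {n} (f g h k : Fin n → ℕ) →
                 sum (λ i → f i + g i + h i + k i) ≡ sum f + sum g + sum h + sum k
sum-distrib-+₄ f g h k =
  trans (sum-distrib-+ (λ i → f i + g i + h i) k) (cong (_+ sum k) (sum-distrib-+₃ f g h))

sum-distribˡ-* : ∀ {n} m (f : Fin n → ℕ) → sum (λ i → m * f i) ≡ m * sum f
sum-distribˡ-* {zero}  m f = sym (*-zeroʳ m)
sum-distribˡ-* {suc n} m f =
  trans (cong (m * f zero +_) (sum-distribˡ-* m (f ∘ suc))) (sym (*-distribˡ-+ m (f zero) _))

sum-zero : ∀ n → sum {n} (λ _ → 0) ≡ 0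
sum-zero zero    = refl
sum-zero (suc n) = sum-zero n

sum-comm : ∀ {m n} (f : Fin m → Fin n → ℕ) →
           sum (λ i → sum (λ j → f i j)) ≡ sum (λ j → sum (λ i → f i j))
sum-comm {zero}  {n} f = sym (sum-zero n)
sum-comm {suc m} {n} f = begin
  sum (f zero) + sum (λ i → sum (f (suc i)))            ≡⟨ cong (sum (f zero) +_) (sum-comm (f ∘ suc)) ⟩
  sum (f zero) + sum (λ j → sum (λ i → f (suc i) j))    ≡⟨ sym (sum-distrib-+ (f zero) _) ⟩
  sum (λ j → f zero j + sum (λ i → f (suc i) j))        ∎
  where open ≡-Reasoning

∣∣≡sum : ∀ {n} (A : VSet n) → ∣ A ∣ ≡ sum (𝟙 ∘ A)
∣∣≡sum {zero}  A = refl
∣∣≡sum {suc n} A = cong (𝟙 (A zero) +_) (∣∣≡sum (A ∘ suc))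

∣∣-cong : ∀ {n} {A B : VSet n} → A ≗ B → ∣ A ∣ ≡ ∣ B ∣
∣∣-cong {zero}  A≗B = refl
∣∣-cong {suc n} A≗B = cong₂ _+_ (cong 𝟙 (A≗B zero)) (∣∣-cong (A≗B ∘ suc))

∣∣-mono : ∀ {n} {A B : VSet n} → A ⊆ B → ∣ A ∣ ≤ ∣ B ∣
∣∣-mono {zero}              A⊆B = z≤n
∣∣-mono {suc n} {A} {B} A⊆B = +-mono-≤ (𝟙-mono (A zero) (B zero) (A⊆B zero)) (∣∣-mono (A⊆B ∘ suc))
  where
  𝟙-mono : ∀ a b → (a ≡ true → b ≡ true) → 𝟙 a ≤ 𝟙 b
  𝟙-mono false b     _   = z≤n
  𝟙-mono true  true  _   = ≤-refl
  𝟙-mono true  false a⇒b with () ← a⇒b refl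

∣∣-pointwise : ∀ {n} {A B C D : VSet n} → (∀ i → 𝟙 (A i) + 𝟙 (B i) ≡ 𝟙 (C i) + 𝟙 (D i)) →
               ∣ A ∣ + ∣ B ∣ ≡ ∣ C ∣ + ∣ D ∣
∣∣-pointwise {zero}                  eq = refl
∣∣-pointwise {suc n} {A} {B} {C} {D} eq = begin
  𝟙 (A zero) + ∣ A ∘ suc ∣ + (𝟙 (B zero) + ∣ B ∘ suc ∣)  ≡⟨ interchange (𝟙 (A zero)) _ _ _ ⟩
  𝟙 (A zero) + 𝟙 (B zero) + (∣ A ∘ suc ∣ + ∣ B ∘ suc ∣)  ≡⟨ cong₂ _+_ (eq zero) (∣∣-pointwise (eq ∘ suc)) ⟩
  𝟙 (C zero) + 𝟙 (D zero) + (∣ C ∘ suc ∣ + ∣ D ∘ suc ∣)  ≡⟨ interchange (𝟙 (C zero)) _ _ _ ⟩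
  𝟙 (C zero) + ∣ C ∘ suc ∣ + (𝟙 (D zero) + ∣ D ∘ suc ∣)  ∎
  where open ≡-Reasoning

∣∅∣ : ∀ {n} → ∣ ∅ {n} ∣ ≡ 0
∣∅∣ {zero}  = refl
∣∅∣ {suc n} = ∣∅∣ {n}

∣full∣ : ∀ {n} → ∣ full {n} ∣ ≡ n
∣full∣ {zero}  = refl
∣full∣ {suc n} = cong suc (∣full∣ {n})

∣∣-inclusion-exclusion : ∀ {n} (A B : VSet n) → ∣ A ∣ + ∣ B ∣ ≡ ∣ A ∩ B ∣ + ∣ A ∪ B ∣
∣∣-inclusion-exclusion A B = ∣∣-pointwise (λ i → lemma (A i) (B i))
  where
  lemma : ∀ a b → 𝟙 a + 𝟙 b ≡ 𝟙 (a ∧ b) + 𝟙 (a ∨ b)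
  lemma false b     = refl
  lemma true  false = refl
  lemma true  true  = refl

∣∪∣≤ : ∀ {n} (A B : VSet n) → ∣ A ∪ B ∣ ≤ ∣ A ∣ + ∣ B ∣
∣∪∣≤ A B = ≤-trans (m≤n+m _ ∣ A ∩ B ∣) (≤-reflexive (sym (∣∣-inclusion-exclusion A B)))

∣∣+∣∁∣ : ∀ {n} (A : VSet n) → ∣ A ∣ + ∣ ∁ A ∣ ≡ n
∣∣+∣∁∣ {n} A = begin
  ∣ A ∣ + ∣ ∁ A ∣           ≡⟨ ∣∣-pointwise {C = ∅} {D = full} (λ i → lemma (A i)) ⟩
  ∣ ∅ {n} ∣ + ∣ full {n} ∣  ≡⟨ cong₂ _+_ (∣∅∣ {n}) (∣full∣ {n}) ⟩
  n                         ∎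
  where
  open ≡-Reasoning
  lemma : ∀ a → 𝟙 a + 𝟙 (not a) ≡ 0 + 1
  lemma false = refl
  lemma true  = refl

∣∣-split : ∀ {n} (A B : VSet n) → ∣ A ∣ ≡ ∣ A ∩ B ∣ + ∣ A ∩ ∁ B ∣
∣∣-split {n} A B = begin
  ∣ A ∣                    ≡⟨ sym (+-identityʳ _) ⟩
  ∣ A ∣ + 0                ≡⟨ cong (∣ A ∣ +_) (sym (∣∅∣ {n})) ⟩
  ∣ A ∣ + ∣ ∅ {n} ∣        ≡⟨ ∣∣-pointwise {B = ∅} (λ i → lemma (A i) (B i)) ⟩
  ∣ A ∩ B ∣ + ∣ A ∩ ∁ B ∣  ∎
  where
  open ≡-Reasoning
  lemma : ∀ a b → 𝟙 a + 0 ≡ 𝟙 (a ∧ b) + 𝟙 (a ∧ not b)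
  lemma false b     = refl
  lemma true  false = refl
  lemma true  true  = refl

∣∣≤n : ∀ {n} (A : VSet n) → ∣ A ∣ ≤ n
∣∣≤n A = ≤-trans (m≤m+n _ _) (≤-reflexive (∣∣+∣∁∣ A))

module _ {n : ℕ} where

  ∈｛｝ : (i : Fin n) → i ∈ ｛ i ｝
  ∈｛｝ i = dec-true (i ≟ i) refl

  ∉｛｝ : ∀ {i j : Fin n} → j ≢ i → j ∉ ｛ i ｝
  ∉｛｝ {i} {j} = dec-false (j ≟ i)

  ∈∧∉⇒≢ : ∀ {A : VSet n} {i j} → i ∈ A → j ∉ A → i ≢ j
  ∈∧∉⇒≢ i∈A j∉A refl with () ← trans (sym i∈A) j∉A

  ∈-remove⁻ : ∀ {A : VSet n} {i j} → j ∈ A ∩ ∁ ｛ i ｝ → j ∈ A × j ≢ i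
  ∈-remove⁻ {A} {i} {j} j∈ =
    ∧-conicalˡ _ _ j∈ , λ j≡i → ∈∧∉⇒≢ (∈｛｝ i) (not-injective (∧-conicalʳ (A j) _ j∈)) (sym j≡i)

∣｛｝∣ : ∀ {n} (i : Fin n) → ∣ ｛ i ｝ ∣ ≡ 1
∣｛｝∣ {suc n} zero    = cong suc (∣∅∣ {n})
∣｛｝∣ {suc n} (suc i) = ∣｛｝∣ i

module _ {n : ℕ} where

  ∈∪⁺ : ∀ (A B : VSet n) {i} → i ∈ A ⊎ i ∈ B → i ∈ A ∪ B
  ∈∪⁺ A B {i} (inj₁ i∈A) = cong (_∨ B i) i∈A
  ∈∪⁺ A B {i} (inj₂ i∈B) = trans (cong (A i ∨_) i∈B) (∨-zeroʳ (A i))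

  ∣∣-remove : ∀ {A : VSet n} {i} → i ∈ A → ∣ A ∣ ≡ suc ∣ A ∩ ∁ ｛ i ｝ ∣
  ∣∣-remove {A} {i} i∈A = begin
    ∣ A ∣                                ≡⟨ ∣∣-split A ｛ i ｝ ⟩
    ∣ A ∩ ｛ i ｝ ∣ + ∣ A ∩ ∁ ｛ i ｝ ∣  ≡⟨ cong (_+ ∣ A ∩ ∁ ｛ i ｝ ∣) (∣∣-cong A∩｛i｝≗｛i｝) ⟩
    ∣ ｛ i ｝ ∣ + ∣ A ∩ ∁ ｛ i ｝ ∣      ≡⟨ cong (_+ ∣ A ∩ ∁ ｛ i ｝ ∣) (∣｛｝∣ i) ⟩
    suc ∣ A ∩ ∁ ｛ i ｝ ∣                ∎
    where
    open ≡-Reasoning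
    A∩｛i｝≗｛i｝ : A ∩ ｛ i ｝ ≗ ｛ i ｝
    A∩｛i｝≗｛i｝ j with j ≟ i
    ... | yes refl = trans (∧-identityʳ (A j)) i∈A
    ... | no  _    = ∧-zeroʳ (A j)

  ∣∣-grow : ∀ {A B : VSet n} {i} → A ⊆ B → i ∉ A → i ∈ B → suc ∣ A ∣ ≤ ∣ B ∣
  ∣∣-grow {A} {B} {i} A⊆B i∉A i∈B =
    ≤-trans (s≤s (∣∣-mono A⊆B∖i)) (≤-reflexive (sym (∣∣-remove i∈B)))
    where
    A⊆B∖i : A ⊆ B ∩ ∁ ｛ i ｝
    A⊆B∖i j j∈A = cong₂ _∧_ (A⊆B j j∈A) (cong not (∉｛｝ (∈∧∉⇒≢ {A = A} j∈A i∉A)))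

nonempty : ∀ {n} {A : VSet n} → 0 < ∣ A ∣ → ∃[ i ] i ∈ A
nonempty {suc n} {A} 0<∣A∣ with A zero in A0
... | true  = zero , A0
... | false = let i , i∈A = nonempty 0<∣A∣ in suc i , i∈A

∣∣<∣∣⇒∃ : ∀ {n} {A B : VSet n} → ∣ A ∣ < ∣ B ∣ → ∃[ i ] i ∈ B × i ∉ A
∣∣<∣∣⇒∃ {A = A} {B} ∣A∣<∣B∣ =
  let i , i∈B∖A = nonempty {A = B ∩ ∁ A} (+-cancelˡ-< ∣ A ∣ 0 _ ∣A∣<∣A∣+∣B∖A∣)
  in i , ∧-conicalˡ _ _ i∈B∖A , not-injective (∧-conicalʳ (B i) _ i∈B∖A)
  where
  ∣A∣<∣A∣+∣B∖A∣ : ∣ A ∣ + 0 < ∣ A ∣ + ∣ B ∩ ∁ A ∣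
  ∣A∣<∣A∣+∣B∖A∣ = begin-strict
    ∣ A ∣ + 0                  ≡⟨ +-identityʳ _ ⟩
    ∣ A ∣                      <⟨ ∣A∣<∣B∣ ⟩
    ∣ B ∣                      ≡⟨ ∣∣-split B A ⟩
    ∣ B ∩ A ∣ + ∣ B ∩ ∁ A ∣    ≤⟨ +-monoˡ-≤ _ (∣∣-mono (λ i → ∧-conicalʳ (B i) _)) ⟩
    ∣ A ∣ + ∣ B ∩ ∁ A ∣        ∎
    where open ≤-Reasoning

Distinct : ∀ {n} → List (Fin n) → Set
Distinct = AllPairs _≢_

distinct⇒≤∣∣ : ∀ {n} {A : VSet n} {l} → Distinct l → All (_∈ A) l → length l ≤ ∣ A ∣
distinct⇒≤∣∣ []                          []          = z≤n
distinct⇒≤∣∣ {A = A} {i ∷ l} (i≢l ∷ dl) (i∈A ∷ l⊆A) =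
  ≤-trans (s≤s (distinct⇒≤∣∣ dl (All.zipWith l⊆A∖i (l⊆A , i≢l))))
          (≤-reflexive (sym (∣∣-remove {A = A} i∈A)))
  where
  l⊆A∖i : ∀ {j} → j ∈ A × i ≢ j → j ∈ A ∩ ∁ ｛ i ｝
  l⊆A∖i (j∈A , i≢j) = cong₂ _∧_ j∈A (cong not (∉｛｝ (≢-sym i≢j)))

∣∣≥⇒distinct : ∀ {n} {A : VSet n} {k} → k ≤ ∣ A ∣ →
               ∃[ l ] length l ≡ k × Distinct l × All (_∈ A) l
∣∣≥⇒distinct {k = zero}      _      = [] , refl , [] , []
∣∣≥⇒distinct {A = A} {suc k} k<∣A∣ =
  let i , i∈A           = nonempty (≤-trans (s≤s z≤n) k<∣A∣)
      l , ∣l∣ , dl , l⊆ = ∣∣≥⇒distinct {A = A ∩ ∁ ｛ i ｝}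
                            (s≤s⁻¹ (≤-trans k<∣A∣ (≤-reflexive (∣∣-remove {A = A} i∈A))))
  in  i ∷ l , cong suc ∣l∣ , All.map (≢-sym ∘ proj₂ ∘ ∈-remove⁻ {A = A}) l⊆ ∷ dl
    , i∈A ∷ All.map (proj₁ ∘ ∈-remove⁻ {A = A}) l⊆

∈⇒1≤∣∣ : ∀ {n} {A : VSet n} {i} → i ∈ A → 1 ≤ ∣ A ∣
∈⇒1≤∣∣ {A = A} i∈A = distinct⇒≤∣∣ {A = A} ([] ∷ []) (i∈A ∷ [])

𝟙+𝟙≤∣∣ : ∀ {n} {A : VSet n} {i j} → i ≢ j → 𝟙 (A i) + 𝟙 (A j) ≤ ∣ A ∣
𝟙+𝟙≤∣∣ {A = A} {i} {j} i≢j with A i in Ai | A j in Aj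
... | false | false = z≤n
... | true  | false = ∈⇒1≤∣∣ {A = A} Ai
... | false | true  = ∈⇒1≤∣∣ {A = A} Aj
... | true  | true  = distinct⇒≤∣∣ {A = A} ((i≢j ∷ []) ∷ [] ∷ []) (Ai ∷ Aj ∷ [])

fromList : ∀ {n} → List (Fin n) → VSet n
fromList []      = ∅
fromList (i ∷ l) = ｛ i ｝ ∪ fromList l

∈fromList : ∀ {n} (l : List (Fin n)) → All (_∈ fromList l) l
∈fromList []      = []
∈fromList (i ∷ l) =
  cong (_∨ fromList l i) (∈｛｝ i) ∷ All.map (λ {j} j∈l → trans (cong (｛ i ｝ j ∨_) j∈l) (∨-zeroʳ _)) (∈fromList l)

∣fromList∣ : ∀ {n} {l : List (Fin n)} → Distinct l → ∣ fromList l ∣ ≡ length l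
∣fromList∣ {n} {l} dl = ≤-antisym (∣fromList∣≤ l) (distinct⇒≤∣∣ dl (∈fromList l))
  where
  ∣fromList∣≤ : ∀ l → ∣ fromList l ∣ ≤ length l
  ∣fromList∣≤ []      = ≤-reflexive (∣∅∣ {n})
  ∣fromList∣≤ (i ∷ l) =
    ≤-trans (∣∪∣≤ ｛ i ｝ (fromList l)) (+-mono-≤ (≤-reflexive (∣｛｝∣ i)) (∣fromList∣≤ l))

distinct⇒≤∣∩fromList∣ : ∀ {n} {B : VSet n} {l} → Distinct l → All (_∈ B) l →
                        length l ≤ ∣ B ∩ fromList l ∣
distinct⇒≤∣∩fromList∣ {l = l} dl l⊆B =
  distinct⇒≤∣∣ dl (All.zipWith (λ (i∈B , i∈l) → cong₂ _∧_ i∈B i∈l) (l⊆B , ∈fromList l))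

module _ {n : ℕ} where

  ∑∈-mono : ∀ (A : VSet n) {f g} → (∀ u → u ∈ A → f u ≤ g u) → ∑∈ A f ≤ ∑∈ A g
  ∑∈-mono A {f} {g} f≤g = sum-mono λ u → lemma u (A u) refl
    where
    lemma : ∀ u a → A u ≡ a → 𝟙 a * f u ≤ 𝟙 a * g u
    lemma u false _   = z≤n
    lemma u true  u∈A = +-monoˡ-≤ 0 (f≤g u u∈A)

  ∑∈-cong : ∀ (A : VSet n) {f g} → (∀ u → u ∈ A → f u ≡ g u) → ∑∈ A f ≡ ∑∈ A g
  ∑∈-cong A {f} {g} f≡g = sum-cong-≗ λ u → lemma u (A u) refl
    where
    lemma : ∀ u a → A u ≡ a → 𝟙 a * f u ≡ 𝟙 a * g u
    lemma u false _   = refl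
    lemma u true  u∈A = cong (_+ 0) (f≡g u u∈A)

  ∑∈-const : ∀ (A : VSet n) m → ∑[ u ∈ A ] m ≡ ∣ A ∣ * m
  ∑∈-const A m = begin
    sum (λ u → 𝟙 (A u) * m)  ≡⟨ sum-cong-≗ (λ u → *-comm (𝟙 (A u)) m) ⟩
    sum (λ u → m * 𝟙 (A u))  ≡⟨ sum-distribˡ-* m (𝟙 ∘ A) ⟩
    m * sum (𝟙 ∘ A)          ≡⟨ cong (m *_) (sym (∣∣≡sum A)) ⟩
    m * ∣ A ∣                ≡⟨ *-comm m _ ⟩
    ∣ A ∣ * m                ∎
    where open ≡-Reasoning

  ∑∈-distrib-+ : ∀ (A : VSet n) f g → ∑[ u ∈ A ] (f u + g u) ≡ ∑∈ A f + ∑∈ A g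
  ∑∈-distrib-+ A f g =
    trans (sum-cong-≗ (λ u → *-distribˡ-+ (𝟙 (A u)) (f u) (g u)))
          (sum-distrib-+ (λ u → 𝟙 (A u) * f u) (λ u → 𝟙 (A u) * g u))

  ∑∈-∣∣ : ∀ (A : VSet n) (P : Fin n → VSet n) →
          ∑[ u ∈ A ] ∣ P u ∣ ≡ sum (λ u → sum (λ w → 𝟙 (A u ∧ P u w)))
  ∑∈-∣∣ A P = sum-cong-≗ λ u → lemma (A u) (P u)
    where
    lemma : ∀ a B → 𝟙 a * ∣ B ∣ ≡ sum (λ w → 𝟙 (a ∧ B w))
    lemma false B = sym (sum-zero n)
    lemma true  B = trans (+-identityʳ ∣ B ∣) (∣∣≡sum B)

  double-count : ∀ (A B : VSet n) (R : Fin n → Fin n → Bool) →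
                 ∑[ u ∈ A ] ∣ R u ∩ B ∣ ≡ ∑[ w ∈ B ] ∣ flip R w ∩ A ∣
  double-count A B R = begin
    ∑[ u ∈ A ] ∣ R u ∩ B ∣
      ≡⟨ ∑∈-∣∣ A (λ u → R u ∩ B) ⟩
    sum (λ u → sum (λ w → 𝟙 (A u ∧ R u w ∧ B w)))
      ≡⟨ sum-comm (λ u w → 𝟙 (A u ∧ R u w ∧ B w)) ⟩
    sum (λ w → sum (λ u → 𝟙 (A u ∧ R u w ∧ B w)))
      ≡⟨ sum-cong-≗ (λ w → sum-cong-≗ (λ u → cong 𝟙 (swap (A u) (R u w) (B w)))) ⟩
    sum (λ w → sum (λ u → 𝟙 (B w ∧ R u w ∧ A u)))
      ≡⟨ sym (∑∈-∣∣ B (λ w → flip R w ∩ A)) ⟩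
    ∑[ w ∈ B ] ∣ flip R w ∩ A ∣
      ∎
    where
    open ≡-Reasoning
    swap : ∀ a r b → a ∧ r ∧ b ≡ b ∧ r ∧ a
    swap false r false = refl
    swap false r true  = sym (∧-zeroʳ r)
    swap true  r false = ∧-zeroʳ r
    swap true  r true  = refl

-- Graphs

NonAdjacent : ∀ {n} → Graph n → Fin n → Fin n → Set
NonAdjacent G u w = u ≢ w × adj G u w ≡ false

common : ∀ {n} → Graph n → Fin n → Fin n → ℕ
common G u w = ∣ adj G u ∩ adj G w ∣

MinimalNonAdjacent : ∀ {n} → Graph n → Fin n → Fin n → Set
MinimalNonAdjacent G x y = NonAdjacent G x y × (∀ u w → NonAdjacent G u w → common G x y ≤ common G u w)

adj⇒≢ : ∀ {n} (G : Graph n) {u v} → adj G u v ≡ true → u ≢ v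
adj⇒≢ G {u} u~v refl = contradiction (trans (sym u~v) (Graph.irrefl G u)) λ ()

degree+degree≤common+n : ∀ {n} (G : Graph n) {x y} → NonAdjacent G x y →
                         degree G x + degree G y + 2 ≤ common G x y + n
degree+degree≤common+n {n} G {x} {y} (x≢y , x≁y) = begin
  degree G x + degree G y + 2         ≡⟨ cong (_+ 2) (∣∣-inclusion-exclusion (adj G x) (adj G y)) ⟩
  common G x y + ∣ N∪ ∣ + 2           ≡⟨ +-assoc (common G x y) ∣ N∪ ∣ 2 ⟩
  common G x y + (∣ N∪ ∣ + 2)         ≤⟨ +-monoʳ-≤ (common G x y) (+-monoʳ-≤ ∣ N∪ ∣ x,y∉N∪) ⟩
  common G x y + (∣ N∪ ∣ + ∣ ∁ N∪ ∣)  ≡⟨ cong (common G x y +_) (∣∣+∣∁∣ N∪) ⟩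
  common G x y + n                    ∎
  where
  open ≤-Reasoning
  N∪ : VSet n
  N∪ = adj G x ∪ adj G y
  x,y∉N∪ : 2 ≤ ∣ ∁ N∪ ∣
  x,y∉N∪ = distinct⇒≤∣∣ {A = ∁ N∪} ((x≢y ∷ []) ∷ [] ∷ [])
    (cong₂ (λ a b → not (a ∨ b)) (Graph.irrefl G x) (trans (Graph.sym G y x) x≁y)
     ∷ cong₂ (λ a b → not (a ∨ b)) x≁y (Graph.irrefl G y) ∷ [])

minimiser : ∀ {A : Set} (P : A → Set) (f : A → ℕ) → (∀ m → Dec (∃[ a ] P a × f a < m)) →
            ∃ P → ∃[ a ] P a × (∀ b → P b → f a ≤ f b)
minimiser P f smaller? (a , Pa) = descend (f a) a Pa ≤-refl
  where
  descend : ∀ m a → P a → f a ≤ m → ∃[ a ] P a × (∀ b → P b → f a ≤ f b)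
  descend m a Pa fa≤m with smaller? (f a)
  ... | no  ¬smaller = a , Pa , λ b Pb → ≮⇒≥ (λ fb<fa → ¬smaller (b , Pb , fb<fa))
  descend zero    a Pa fa≤0   | yes (b , Pb , fb<fa) = contradiction (≤-trans fb<fa fa≤0) λ ()
  descend (suc m) a Pa fa≤1+m | yes (b , Pb , fb<fa) = descend m b Pb (s≤s⁻¹ (≤-trans fb<fa fa≤1+m))

minimal-non-adjacent : ∀ {n} (G : Graph n) {u w} → NonAdjacent G u w →
                       ∃[ x ] ∃[ y ] MinimalNonAdjacent G x y
minimal-non-adjacent G {u} {w} u≁w =
  let (x , y) , x≁y , minimal = minimiser (uncurry (NonAdjacent G)) (uncurry (common G)) smaller? ((u , w) , u≁w)
  in  x , y , x≁y , λ u w → minimal (u , w)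
  where
  smaller? : ∀ m → Dec (∃[ p ] uncurry (NonAdjacent G) p × uncurry (common G) p < m)
  smaller? m = map′ (λ (u , w , h) → (u , w) , h) (λ ((u , w) , h) → u , w , h)
    (any? λ u → any? λ w → (¬? (u ≟ w) ×-dec (adj G u w ≟ᴮ false)) ×-dec (common G u w <? m))

-- Bootstrap percolation

module Bootstrap {n : ℕ} (G : Graph n) (r : ℕ) where

  Closed : VSet n → Set
  Closed S = ∀ v → v ∉ S → ∣ adj G v ∩ S ∣ < r

  step-extensive : ∀ A → A ⊆ step G r A
  step-extensive A v v∈A = cong (_∨ (r ≤ᵇ ∣ adj G v ∩ A ∣)) v∈A

  step-infects : ∀ {A v} → r ≤ ∣ adj G v ∩ A ∣ → v ∈ step G r A
  step-infects {A} {v} r≤ = trans (cong (A v ∨_) (Equivalence.to T-≡ (≤⇒≤ᵇ r≤))) (∨-zeroʳ (A v))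

  closed-absorbs : ∀ {S A} → Closed S → A ⊆ S → step G r A ⊆ S
  closed-absorbs {S} {A} S-closed A⊆S v v∈stepA with S v in Sv | A v in Av
  ... | true  | _     = refl
  ... | false | true  with () ← trans (sym (A⊆S v Av)) Sv
  ... | false | false = contradiction (≤ᵇ⇒≤ r _ (Equivalence.from T-≡ v∈stepA)) (<⇒≱ (begin-strict
    ∣ adj G v ∩ A ∣  ≤⟨ ∣∣-mono N[v]∩A⊆N[v]∩S ⟩
    ∣ adj G v ∩ S ∣  <⟨ S-closed v Sv ⟩
    r                ∎))
    where
    open ≤-Reasoning
    N[v]∩A⊆N[v]∩S : adj G v ∩ A ⊆ adj G v ∩ S
    N[v]∩A⊆N[v]∩S u u∈ = cong₂ _∧_ (∧-conicalˡ _ _ u∈) (A⊆S u (∧-conicalʳ (adj G v u) _ u∈))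

  closure-⊆ : ∀ {S A} → Closed S → A ⊆ S → ∀ t → bootstrap G r A t ⊆ S
  closure-⊆ S-closed A⊆S zero    = A⊆S
  closure-⊆ S-closed A⊆S (suc t) = closed-absorbs S-closed (closure-⊆ S-closed A⊆S t)

  ⊆-closure : ∀ A t → A ⊆ bootstrap G r A t
  ⊆-closure A zero    v v∈A = v∈A
  ⊆-closure A (suc t) v v∈A = step-extensive _ v (⊆-closure A t v v∈A)

  closed-or-grows : ∀ S → Closed S ⊎ ∃[ v ] v ∉ S × v ∈ step G r S
  closed-or-grows S with any? (λ v → (S v ≟ᴮ false) ×-dec (r ≤? ∣ adj G v ∩ S ∣))
  ... | yes (v , v∉S , r≤) = inj₂ (v , v∉S , step-infects r≤)
  ... | no  ¬grows         = inj₁ (λ v v∉S → ≰⇒> (λ r≤ → ¬grows (v , v∉S , r≤)))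

  grows-or-stabilises : ∀ A t → t ≤ ∣ bootstrap G r A t ∣ ⊎ ∃[ t′ ] Closed (bootstrap G r A t′)
  grows-or-stabilises A zero = inj₁ z≤n
  grows-or-stabilises A (suc t) with grows-or-stabilises A t
  ... | inj₂ stable = inj₂ stable
  ... | inj₁ t≤∣Aₜ∣ with closed-or-grows (bootstrap G r A t)
  ...   | inj₁ closed          = inj₂ (t , closed)
  ...   | inj₂ (v , v∉Aₜ , v∈Aₜ₊₁) =
    inj₁ (≤-trans (s≤s t≤∣Aₜ∣) (∣∣-grow (step-extensive _) v∉Aₜ v∈Aₜ₊₁))

  bootstrap-stabilises : ∀ A → ∃[ t ] Closed (bootstrap G r A t)
  bootstrap-stabilises A with grows-or-stabilises A (suc n)
  ... | inj₁ n<∣A∣ = contradiction n<∣A∣ (<⇒≱ (s≤s (∣∣≤n _)))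
  ... | inj₂ stable = stable

  small-sets-closed : ∀ {A} → ∣ A ∣ < r → Closed A
  small-sets-closed ∣A∣<r v _ = ≤-trans (s≤s (∣∣-mono (λ u → ∧-conicalʳ (adj G v u) _))) ∣A∣<r

  percolating-sets-are-large : r ≤ n → ∀ A → Percolates G r A → r ≤ ∣ A ∣
  percolating-sets-are-large r≤n A percolates = ≮⇒≥ λ ∣A∣<r →
    let v , _ , v∉A = ∣∣<∣∣⇒∃ {A = A} {B = full} (≤-trans ∣A∣<r (≤-trans r≤n (≤-reflexive (sym ∣full∣))))
        t , v∈Aₜ   = percolates v
    in  ∈∧∉⇒≢ {A = A} (closure-⊆ (small-sets-closed ∣A∣<r) (λ _ v∈A → v∈A) t v v∈Aₜ) v∉A refl

  complete-graphs-percolate : (∀ u w → ¬ NonAdjacent G u w) → r ≤ n → ∃[ A ] ∣ A ∣ ≡ r × Percolates G r A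
  complete-graphs-percolate complete r≤n with ∣∣≥⇒distinct {A = full} (≤-trans r≤n (≤-reflexive (sym ∣full∣)))
  ... | l , ∣l∣≡r , dl , _ = fromList l , trans (∣fromList∣ dl) ∣l∣≡r , percolates
    where
    adjacent : ∀ {v i} → v ≢ i → adj G v i ≡ true
    adjacent {v} {i} v≢i with adj G v i in v~i
    ... | true  = refl
    ... | false = contradiction (v≢i , v~i) (complete v i)

    percolates : Percolates G r (fromList l)
    percolates v with fromList l v in v∈A?
    ... | true  = 0 , v∈A?
    ... | false = 1 , step-infects (subst (_≤ ∣ adj G v ∩ fromList l ∣) ∣l∣≡r (distinct⇒≤∣∩fromList∣ dl l⊆N[v]))
      where
      l⊆N[v] : All (_∈ adj G v) l
      l⊆N[v] = All.map (λ i∈A → adjacent (≢-sym (∈∧∉⇒≢ {A = fromList l} i∈A v∈A?))) (∈fromList l)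

-- Counting degrees around a closed set

infixl 6 _⊕_
_⊕_ : ∀ {a b c d} → a ≤ b → c ≤ d → a + c ≤ b + d
_⊕_ = +-mono-≤

module DegreeCounting {n : ℕ} (G : Graph n) (S : VSet n) where

  open Bootstrap G using (Closed)

  s t : ℕ
  s = ∣ S ∣
  t = ∣ ∁ S ∣

  degS degT : Fin n → ℕ
  degS u = ∣ adj G u ∩ S ∣
  degT u = ∣ adj G u ∩ ∁ S ∣

  nonNbrs : Fin n → VSet n
  nonNbrs u = (S ∩ ∁ ｛ u ｝) ∩ ∁ (adj G u)

  nonDegS : Fin n → ℕ
  nonDegS u = ∣ nonNbrs u ∣

  ∑degS ∑degT ∑nonDegS : ℕ
  ∑degS    = ∑[ u ∈ S ] degS u
  ∑degT    = ∑[ u ∈ S ] degT u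
  ∑nonDegS = ∑[ u ∈ S ] nonDegS u

  degree-split : ∀ u → degree G u ≡ degS u + degT u
  degree-split u = ∣∣-split (adj G u) S

  edges-across : ∀ {r} → Closed (suc r) S → ∑degT ≤ t * r
  edges-across {r} S-closed = begin
    ∑degT                                ≡⟨ double-count S (∁ S) (adj G) ⟩
    ∑[ w ∈ ∁ S ] ∣ flip (adj G) w ∩ S ∣  ≡⟨ ∑∈-cong (∁ S) (λ w _ → ∣∣-cong (λ u → cong (_∧ S u) (Graph.sym G u w))) ⟩
    ∑[ w ∈ ∁ S ] degS w                  ≤⟨ ∑∈-mono (∁ S) (λ w → s≤s⁻¹ ∘ S-closed w ∘ not-injective) ⟩
    ∑[ w ∈ ∁ S ] r                       ≡⟨ ∑∈-const (∁ S) r ⟩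
    t * r                                ∎
    where open ≤-Reasoning

  complement-large : ∀ {r w} → Closed (suc r) S → w ∉ S → suc (degree G w) ≤ r + t
  complement-large {r} {w} S-closed w∉S = begin
    suc (degree G w)       ≡⟨ cong suc (degree-split w) ⟩
    suc (degS w + degT w)  ≡⟨ sym (+-suc _ _) ⟩
    degS w + suc (degT w)  ≤⟨ +-mono-≤ (s≤s⁻¹ (S-closed w w∉S)) (∣∣-grow N[w]∖S⊆∁S w∉N[w] (cong not w∉S)) ⟩
    r + t                  ∎
    where
    open ≤-Reasoning
    N[w]∖S⊆∁S : adj G w ∩ ∁ S ⊆ ∁ S
    N[w]∖S⊆∁S v = ∧-conicalʳ (adj G w v) _
    w∉N[w] : w ∉ adj G w ∩ ∁ S
    w∉N[w] = cong (_∧ not (S w)) (Graph.irrefl G w)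

  common≤degT+degS : ∀ u w → common G u w ≤ degT u + degS w
  common≤degT+degS u w =
    ≤-trans (∣∣-mono {B = (adj G u ∩ ∁ S) ∪ (adj G w ∩ S)} (λ z → split (adj G u z) (adj G w z) (S z)))
            (∣∪∣≤ (adj G u ∩ ∁ S) (adj G w ∩ S))
    where
    split : ∀ a b c → a ∧ b ≡ true → (a ∧ not c) ∨ (b ∧ c) ≡ true
    split true true false _ = refl
    split true true true  _ = refl

  degT-large : ∀ {r c u} → Closed (suc r) S → (∀ u w → NonAdjacent G u w → c ≤ common G u w) → u ∈ S →
               c ≤ degT u + r ⊎ t ≤ degT u
  degT-large {r} {c} {u} S-closed c≤common u∈S with degT u <? t
  ... | no  degT≮t = inj₂ (≮⇒≥ degT≮t)
  ... | yes degT<t =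
    let w , w∈∁S , w∉N[u]∖S = ∣∣<∣∣⇒∃ {A = adj G u ∩ ∁ S} {B = ∁ S} degT<t
        w∉S = not-injective w∈∁S
        u≁w = trans (sym (∧-identityʳ (adj G u w))) (trans (cong (adj G u w ∧_) (sym w∈∁S)) w∉N[u]∖S)
    in  inj₁ (begin
          c                ≤⟨ c≤common u w (∈∧∉⇒≢ {A = S} u∈S w∉S , u≁w) ⟩
          common G u w     ≤⟨ common≤degT+degS u w ⟩
          degT u + degS w  ≤⟨ +-monoʳ-≤ (degT u) (s≤s⁻¹ (S-closed w w∉S)) ⟩
          degT u + r       ∎)
    where open ≤-Reasoning

  degS+nonDegS : ∀ {u} → u ∈ S → suc (degS u + nonDegS u) ≡ s
  degS+nonDegS {u} u∈S = sym (begin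
    s                                                ≡⟨ ∣∣-remove {A = S} u∈S ⟩
    suc ∣ S ∩ ∁ ｛ u ｝ ∣                            ≡⟨ cong suc (∣∣-split (S ∩ ∁ ｛ u ｝) (adj G u)) ⟩
    suc (∣ (S ∩ ∁ ｛ u ｝) ∩ adj G u ∣ + nonDegS u)  ≡⟨ cong (λ m → suc (m + nonDegS u)) (∣∣-cong nbrs) ⟩
    suc (degS u + nonDegS u)                         ∎)
    where
    open ≡-Reasoning
    nbrs : (S ∩ ∁ ｛ u ｝) ∩ adj G u ≗ adj G u ∩ S
    nbrs v with v ≟ u
    ... | yes refl = trans (cong (_∧ adj G u u) (∧-zeroʳ (S u))) (sym (cong (_∧ S u) (Graph.irrefl G u)))
    ... | no  _    = trans (cong (_∧ adj G u v) (∧-identityʳ (S v))) (∧-comm (S v) (adj G u v))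

  ∑degS+∑nonDegS : ∑degS + ∑nonDegS + s ≡ s * s
  ∑degS+∑nonDegS = begin
    ∑degS + ∑nonDegS + s                            ≡⟨ +-comm (∑degS + ∑nonDegS) s ⟩
    s + (∑degS + ∑nonDegS)                          ≡⟨ cong (_+ (∑degS + ∑nonDegS)) (sym (*-identityʳ s)) ⟩
    s * 1 + (∑degS + ∑nonDegS)                      ≡⟨ sym (cong₂ _+_ (∑∈-const S 1) (∑∈-distrib-+ S degS nonDegS)) ⟩
    ∑[ u ∈ S ] 1 + ∑[ u ∈ S ] (degS u + nonDegS u)  ≡⟨ sym (∑∈-distrib-+ S (λ _ → 1) (λ u → degS u + nonDegS u)) ⟩
    ∑[ u ∈ S ] suc (degS u + nonDegS u)             ≡⟨ ∑∈-cong S (λ u → degS+nonDegS) ⟩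
    ∑[ u ∈ S ] s                                    ≡⟨ ∑∈-const S s ⟩
    s * s                                           ∎
    where open ≡-Reasoning

  nonNbrs-∈S : ∀ {u v} → v ∈ S → v ≢ u → nonNbrs u v ≡ not (adj G v u)
  nonNbrs-∈S {u} {v} v∈S v≢u =
    trans (cong₂ (λ a b → (a ∧ not b) ∧ not (adj G u v)) v∈S (∉｛｝ v≢u)) (cong not (Graph.sym G u v))

  ∈nonNbrs : ∀ {u v} → v ∈ S → v ≢ u → adj G v u ≡ false → v ∈ nonNbrs u
  ∈nonNbrs v∈S v≢u v≁u = trans (nonNbrs-∈S v∈S v≢u) (cong not v≁u)

  module NonAdjacentPair {x y} (x≢y : x ≢ y) (x≁y : adj G x y ≡ false) (x∈S : x ∈ S) (y∈S : y ∈ S) where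

    y≁x : adj G y x ≡ false
    y≁x = trans (Graph.sym G y x) x≁y

    X : ℕ
    X = nonDegS x + nonDegS y

    2≤X : 2 ≤ X
    2≤X = +-mono-≤ (∈⇒1≤∣∣ {A = nonNbrs x} (∈nonNbrs y∈S (≢-sym x≢y) y≁x))
                   (∈⇒1≤∣∣ {A = nonNbrs y} (∈nonNbrs x∈S x≢y x≁y))

    S-covered : s ≤ common G x y + X
    S-covered = ≤-trans (∣∣-mono covered)
      (≤-trans (∣∪∣≤ Common NonNbrs) (+-monoʳ-≤ (common G x y) (∣∪∣≤ (nonNbrs x) (nonNbrs y))))
      where
      Common NonNbrs : VSet n
      Common  = adj G x ∩ adj G y
      NonNbrs = nonNbrs x ∪ nonNbrs y

      true-or-false : ∀ b → b ≡ true ⊎ b ≡ false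
      true-or-false true  = inj₁ refl
      true-or-false false = inj₂ refl

      classify : ∀ z → z ∈ S → z ∈ Common ⊎ z ∈ nonNbrs x ⊎ z ∈ nonNbrs y
      classify z z∈S with true-or-false (adj G x z) | true-or-false (adj G y z)
      ... | inj₁ x~z | inj₁ y~z = inj₁ (cong₂ _∧_ x~z y~z)
      ... | inj₂ x≁z | _ with toSum (z ≟ x)
      ...   | inj₁ refl = inj₂ (inj₂ (∈nonNbrs x∈S x≢y x≁y))
      ...   | inj₂ z≢x  = inj₂ (inj₁ (∈nonNbrs z∈S z≢x (trans (Graph.sym G z x) x≁z)))
      classify z z∈S | inj₁ x~z | inj₂ y≁z with toSum (z ≟ y)
      ...   | inj₁ refl = contradiction (trans (sym x~z) x≁y) λ ()
      ...   | inj₂ z≢y  = inj₂ (inj₂ (∈nonNbrs z∈S z≢y (trans (Graph.sym G z y) y≁z)))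

      covered : S ⊆ Common ∪ NonNbrs
      covered z z∈S = ∈∪⁺ Common NonNbrs (Sum.map₂ (∈∪⁺ (nonNbrs x) (nonNbrs y)) (classify z z∈S))

    -- For u ∈ S ∖ {x, y}, being a non-neighbour of x (or y) makes x (or y) a non-neighbour of u.
    non-edges-at : ∀ u → 𝟙 (nonNbrs x u) + 𝟙 (nonNbrs y u) + 𝟙 (｛ x ｝ u) * nonDegS x + 𝟙 (｛ y ｝ u) * nonDegS y
                         ≤ 𝟙 (S u) * nonDegS u + 𝟙 (｛ x ｝ u) + 𝟙 (｛ y ｝ u)
    non-edges-at u with u ≟ x | u ≟ y
    ... | yes refl | yes x≡y = contradiction x≡y x≢y
    ... | yes refl | no  _   rewrite x∈S | y≁x = ≤-reflexive (at-x (nonDegS x))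
      where
      at-x : ∀ m → 1 + (m + 0) + 0 ≡ m + 0 + 1 + 0
      at-x = solve-∀
    ... | no  _    | yes refl rewrite y∈S | x≁y = ≤-reflexive (at-y (nonDegS y))
      where
      at-y : ∀ m → 1 + (m + 0) ≡ m + 0 + 0 + 1
      at-y = solve-∀
    ... | no  u≢x  | no  u≢y with S u
    ...   | false = z≤n
    ...   | true  = +-mono-≤ (+-mono-≤ (≤-trans x,y∈nonNbrs[u] (m≤m+n _ 0)) z≤n) z≤n
      where
      x,y∈nonNbrs[u] : 𝟙 (not (adj G x u)) + 𝟙 (not (adj G y u)) ≤ nonDegS u
      x,y∈nonNbrs[u] = subst₂ (λ a b → 𝟙 a + 𝟙 b ≤ nonDegS u)
        (nonNbrs-∈S x∈S (≢-sym u≢x)) (nonNbrs-∈S y∈S (≢-sym u≢y)) (𝟙+𝟙≤∣∣ {A = nonNbrs u} x≢y)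

    non-edges-in-S : 2 * X ≤ ∑nonDegS + 2
    non-edges-in-S = begin
      2 * X                                                   ≡⟨ double (nonDegS x) (nonDegS y) ⟩
      nonDegS x + nonDegS y + 1 * nonDegS x + 1 * nonDegS y  ≡⟨ sym lhs-sum ⟩
      sum (λ u → 𝟙 (nonNbrs x u) + 𝟙 (nonNbrs y u) + 𝟙 (｛ x ｝ u) * nonDegS x + 𝟙 (｛ y ｝ u) * nonDegS y)
                                                              ≤⟨ sum-mono non-edges-at ⟩
      sum (λ u → 𝟙 (S u) * nonDegS u + 𝟙 (｛ x ｝ u) + 𝟙 (｛ y ｝ u))
                                                              ≡⟨ rhs-sum ⟩
      ∑nonDegS + 1 + 1                                        ≡⟨ +-assoc ∑nonDegS 1 1 ⟩
      ∑nonDegS + 2                                            ∎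
      where
      open ≤-Reasoning
      double : ∀ a b → 2 * (a + b) ≡ a + b + 1 * a + 1 * b
      double = solve-∀

      ∑∈｛｝ : ∀ i m → ∑[ u ∈ ｛ i ｝ ] m ≡ 1 * m
      ∑∈｛｝ i m = trans (∑∈-const ｛ i ｝ m) (cong (_* m) (∣｛｝∣ i))

      lhs-sum : sum (λ u → 𝟙 (nonNbrs x u) + 𝟙 (nonNbrs y u) + 𝟙 (｛ x ｝ u) * nonDegS x + 𝟙 (｛ y ｝ u) * nonDegS y)
              ≡ nonDegS x + nonDegS y + 1 * nonDegS x + 1 * nonDegS y
      lhs-sum = trans (sum-distrib-+₄ (𝟙 ∘ nonNbrs x) (𝟙 ∘ nonNbrs y) _ _)
        (cong₂ _+_ (cong₂ _+_ (cong₂ _+_ (sym (∣∣≡sum (nonNbrs x))) (sym (∣∣≡sum (nonNbrs y)))) (∑∈｛｝ x _))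
                   (∑∈｛｝ y _))

      rhs-sum : sum (λ u → 𝟙 (S u) * nonDegS u + 𝟙 (｛ x ｝ u) + 𝟙 (｛ y ｝ u)) ≡ ∑nonDegS + 1 + 1
      rhs-sum = trans (sum-distrib-+₃ (λ u → 𝟙 (S u) * nonDegS u) (𝟙 ∘ ｛ x ｝) (𝟙 ∘ ｛ y ｝))
        (cong₂ _+_ (cong (∑nonDegS +_) (trans (sym (∣∣≡sum ｛ x ｝)) (∣｛｝∣ x)))
                   (trans (sym (∣∣≡sum ｛ y ｝)) (∣｛｝∣ y)))

    edges-inside : ∑degS + 2 * X + s ≤ s * s + 2
    edges-inside = begin
      ∑degS + 2 * X + s              ≤⟨ ≤-refl {∑degS} ⊕ non-edges-in-S ⊕ ≤-refl {s} ⟩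
      ∑degS + (∑nonDegS + 2) + s     ≡⟨ shuffle ∑degS ∑nonDegS s ⟩
      ∑degS + ∑nonDegS + s + 2       ≡⟨ cong (_+ 2) ∑degS+∑nonDegS ⟩
      s * s + 2                      ∎
      where
      open ≤-Reasoning
      shuffle : ∀ a b c → a + (b + 2) + c ≡ a + b + c + 2
      shuffle = solve-∀

-- An arithmetic contradiction

refute : ∀ {a b} → a ≤ b → ∀ e → a ≡ b + suc e → ⊥
refute {b = b} a≤b e a≡b+1+e = m+1+n≰m b (subst (_≤ b) a≡b+1+e a≤b)

-- Writing k + 1 = s + j, each case adds hypotheses up to an inequality a ≤ b with a = b + 1 + e.
counting-bounds-inconsistent : ∀ {k s t c X} →
  15 ≤ k → k ≤ t → s + t ≤ 2 * k + 1 → 5 ≤ s → 2 ≤ X → s ≤ c + X →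
  s * (k + 1) + 2 * X + s ≤ t * 2 + s * s + 2 → (5 ≤ c → s * 3 ≤ t * 2) → ⊥
counting-bounds-inconsistent {k} {s} {t} {c} {X} 15≤k k≤t s+t≤2k+1 5≤s 2≤X s≤c+X degrees dense =
  let j , s+j≡k+1 = m≤n⇒∃[o]m+o≡n s≤k+1
  in  by-excess j (subst (16 ≤_) (sym s+j≡k+1) (15≤k ⊕ ≤-refl {1}))
                  (subst (λ m → s + t + 1 ≤ 2 * m) (sym s+j≡k+1) s+t+1≤2[k+1])
                  (subst (λ m → s * m + 2 * X + s ≤ t * 2 + s * s + 2) (sym s+j≡k+1) degrees)
  where
  s+t+1≤2[k+1] : s + t + 1 ≤ 2 * (k + 1)
  s+t+1≤2[k+1] = ≤-trans (s+t≤2k+1 ⊕ ≤-refl {1}) (≤-reflexive (solve (List ℕ ∋ k ∷ [])))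

  s≤k+1 : s ≤ k + 1
  s≤k+1 = +-cancelʳ-≤ k s (k + 1)
    (≤-trans (≤-refl {s} ⊕ k≤t) (≤-trans s+t≤2k+1 (≤-reflexive (solve (List ℕ ∋ k ∷ [])))))

  s≤4+X : ¬ 5 ≤ c → s ≤ 4 + X
  s≤4+X c≱5 = ≤-trans s≤c+X (s≤s⁻¹ (≰⇒> c≱5) ⊕ ≤-refl)

  by-excess : ∀ j → 16 ≤ s + j → s + t + 1 ≤ 2 * (s + j) → s * (s + j) + 2 * X + s ≤ t * 2 + s * s + 2 → ⊥
  by-excess 0 16≤s b a with 5 ≤? c
  ... | yes 5≤c = refute (dense 5≤c ⊕ b ⊕ b) (s + 1) (solve (List ℕ ∋ s ∷ t ∷ []))
  ... | no  c≱5 =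
    refute (a ⊕ b ⊕ b ⊕ s≤4+X c≱5 ⊕ s≤4+X c≱5 ⊕ 16≤s) 7 (solve (List ℕ ∋ s ∷ t ∷ X ∷ []))
  by-excess 1 16≤s+1 b a with 5 ≤? c
  ... | yes 5≤c = refute (dense 5≤c ⊕ b ⊕ b ⊕ 5≤s) 2 (solve (List ℕ ∋ s ∷ t ∷ []))
  ... | no  c≱5 =
    refute (a ⊕ b ⊕ b ⊕ s≤4+X c≱5 ⊕ s≤4+X c≱5 ⊕ 16≤s+1) (s + 2) (solve (List ℕ ∋ s ∷ t ∷ X ∷ []))
  by-excess (suc (suc i)) _ b a =
    refute (a ⊕ b ⊕ b ⊕ *-mono-≤ 5≤s (≤-refl {suc i}) ⊕ *-mono-≤ (≤-refl {2}) 2≤X) i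
           (solve (List ℕ ∋ s ∷ t ∷ X ∷ i ∷ []))

-- Three vertices percolate

module UpperBound {n : ℕ} (G : Graph n) {k : ℕ} (δ≥k+1 : minDegree≥ G (k + 1))
                  (15≤k : 15 ≤ k) (n≤2k+1 : n ≤ 2 * k + 1) where

  open Bootstrap G 3

  closed-superset-is-full : ∀ {S x y} → Closed S → MinimalNonAdjacent G x y →
                            x ∈ S → y ∈ S → 5 ≤ ∣ S ∣ → ∀ w → w ∈ S
  closed-superset-is-full {S} {x} {y} S-closed ((x≢y , x≁y) , minimal) x∈S y∈S 5≤s w with S w in Sw
  ... | true  = refl
  ... | false = ⊥-elim (counting-bounds-inconsistent 15≤k k≤t s+t≤2k+1 5≤s 2≤X S-covered degrees dense)
    where
    open DegreeCounting G S
    open NonAdjacentPair x≢y x≁y x∈S y∈S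
    open ≤-Reasoning

    k≤t : k ≤ t
    k≤t = +-cancelˡ-≤ 2 k t (begin
      2 + k             ≡⟨ cong suc (+-comm 1 k) ⟩
      suc (k + 1)       ≤⟨ s≤s (δ≥k+1 w) ⟩
      suc (degree G w)  ≤⟨ complement-large S-closed Sw ⟩
      2 + t             ∎)

    s+t≤2k+1 : s + t ≤ 2 * k + 1
    s+t≤2k+1 = ≤-trans (≤-reflexive (∣∣+∣∁∣ S)) n≤2k+1

    degree-sum : s * (k + 1) ≤ ∑degT + ∑degS
    degree-sum = begin
      s * (k + 1)                   ≡⟨ sym (∑∈-const S (k + 1)) ⟩
      ∑[ u ∈ S ] (k + 1)            ≤⟨ ∑∈-mono S (λ u _ → δ≥k+1 u) ⟩
      ∑[ u ∈ S ] degree G u         ≡⟨ ∑∈-cong S (λ u _ → trans (degree-split u) (+-comm (degS u) (degT u))) ⟩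
      ∑[ u ∈ S ] (degT u + degS u)  ≡⟨ ∑∈-distrib-+ S degT degS ⟩
      ∑degT + ∑degS                 ∎

    degrees : s * (k + 1) + 2 * X + s ≤ t * 2 + s * s + 2
    degrees = begin
      s * (k + 1) + 2 * X + s      ≤⟨ degree-sum ⊕ ≤-refl {2 * X} ⊕ ≤-refl {s} ⟩
      ∑degT + ∑degS + 2 * X + s    ≡⟨ trans (cong (_+ s) (+-assoc ∑degT ∑degS (2 * X))) (+-assoc ∑degT _ s) ⟩
      ∑degT + (∑degS + 2 * X + s)  ≤⟨ edges-across S-closed ⊕ edges-inside ⟩
      t * 2 + (s * s + 2)          ≡⟨ sym (+-assoc (t * 2) (s * s) 2) ⟩
      t * 2 + s * s + 2            ∎

    dense : 5 ≤ common G x y → s * 3 ≤ t * 2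
    dense 5≤c = begin
      s * 3         ≡⟨ sym (∑∈-const S 3) ⟩
      ∑[ u ∈ S ] 3  ≤⟨ ∑∈-mono S (λ u → 3≤degT) ⟩
      ∑degT         ≤⟨ edges-across S-closed ⟩
      t * 2         ∎
      where
      3≤degT : ∀ {u} → u ∈ S → 3 ≤ degT u
      3≤degT {u} u∈S with degT-large S-closed minimal u∈S
      ... | inj₁ c≤degT+2 = +-cancelʳ-≤ 2 3 (degT u) (≤-trans 5≤c c≤degT+2)
      ... | inj₂ t≤degT   = ≤-trans (m≤m+n 3 12) (≤-trans 15≤k (≤-trans k≤t t≤degT))

  3≤common : ∀ {x y} → NonAdjacent G x y → 3 ≤ common G x y
  3≤common {x} {y} x≁y = +-cancelʳ-≤ (2 * k + 1) 3 (common G x y) (begin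
    3 + (2 * k + 1)              ≡⟨ solve (List ℕ ∋ k ∷ []) ⟩
    k + 1 + (k + 1) + 2          ≤⟨ δ≥k+1 x ⊕ δ≥k+1 y ⊕ ≤-refl ⟩
    degree G x + degree G y + 2  ≤⟨ degree+degree≤common+n G x≁y ⟩
    common G x y + n             ≤⟨ +-monoʳ-≤ (common G x y) n≤2k+1 ⟩
    common G x y + (2 * k + 1)   ∎)
    where open ≤-Reasoning

  common-neighbours-percolate : ∀ {x y l} → MinimalNonAdjacent G x y → length l ≡ 3 → Distinct l →
                                All (_∈ adj G x ∩ adj G y) l → Percolates G 3 (fromList l)
  common-neighbours-percolate {x} {y} {l} minimal@((x≢y , _) , _) ∣l∣≡3 dl l⊆N[x]∩N[y] v =
    proj₁ stable , closed-superset-is-full (proj₂ stable) minimal (infected l⊆N[x]) (infected l⊆N[y]) 5≤∣S∣ v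
    where
    A : VSet n
    A = fromList l

    stable : ∃[ t ] Closed (bootstrap G 3 A t)
    stable = bootstrap-stabilises A

    S : VSet n
    S = bootstrap G 3 A (proj₁ stable)

    A⊆S : A ⊆ S
    A⊆S = ⊆-closure A (proj₁ stable)

    l⊆N[x] : All (_∈ adj G x) l
    l⊆N[x] = All.map (∧-conicalˡ _ _) l⊆N[x]∩N[y]

    l⊆N[y] : All (_∈ adj G y) l
    l⊆N[y] = All.map (λ {i} → ∧-conicalʳ (adj G x i) _) l⊆N[x]∩N[y]

    infected : ∀ {u} → All (_∈ adj G u) l → u ∈ S
    infected {u} l⊆N[u] = closed-absorbs (proj₂ stable) A⊆S u
      (step-infects (subst (_≤ ∣ adj G u ∩ A ∣) ∣l∣≡3 (distinct⇒≤∣∩fromList∣ dl l⊆N[u])))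

    5≤∣S∣ : 5 ≤ ∣ S ∣
    5≤∣S∣ = subst (λ m → 2 + m ≤ ∣ S ∣) ∣l∣≡3 (distinct⇒≤∣∣ {A = S}
      ((x≢y ∷ All.map (adj⇒≢ G) l⊆N[x]) ∷ All.map (adj⇒≢ G) l⊆N[y] ∷ dl)
      (infected l⊆N[x] ∷ infected l⊆N[y] ∷ All.map (A⊆S _) (∈fromList l)))

  minimal-pair-percolates : ∀ {x y} → MinimalNonAdjacent G x y → ∃[ A ] ∣ A ∣ ≡ 3 × Percolates G 3 A
  minimal-pair-percolates minimal@(x≁y , _) =
    let l , ∣l∣≡3 , dl , l⊆N[x]∩N[y] = ∣∣≥⇒distinct (3≤common x≁y)
    in  fromList l , trans (∣fromList∣ dl) ∣l∣≡3 , common-neighbours-percolate minimal ∣l∣≡3 dl l⊆N[x]∩N[y]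

  percolating-triple : 3 ≤ n → ∃[ A ] ∣ A ∣ ≡ 3 × Percolates G 3 A
  percolating-triple 3≤n with any? (λ u → any? (λ w → ¬? (u ≟ w) ×-dec (adj G u w ≟ᴮ false)))
  ... | yes (_ , _ , u≁w) = let _ , _ , minimal = minimal-non-adjacent G u≁w in minimal-pair-percolates minimal
  ... | no  ∄non-adjacent = complete-graphs-percolate (λ u w u≁w → ∄non-adjacent (u , w , u≁w)) 3≤n

theorem1p2 : (n : ℕ) → 30 ≤ n → (G : Graph n) → minDegree≥ G (n / 2 + 1) → m≡ G 3 3
theorem1p2 n 30≤n G δ≥n/2+1 =
  UpperBound.percolating-triple G δ≥n/2+1 (/-monoˡ-≤ 2 30≤n) n≤2[n/2]+1 3≤n ,
  Bootstrap.percolating-sets-are-large G 3 3≤n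
  where
  3≤n : 3 ≤ n
  3≤n = ≤-trans (m≤m+n 3 27) 30≤n

  n≤2[n/2]+1 : n ≤ 2 * (n / 2) + 1
  n≤2[n/2]+1 = begin
    n                      ≡⟨ m≡m%n+[m/n]*n n 2 ⟩
    n % 2 + n / 2 * 2      ≤⟨ +-monoˡ-≤ (n / 2 * 2) (s≤s⁻¹ (m%n<n n 2)) ⟩
    1 + n / 2 * 2          ≡⟨ trans (+-comm 1 _) (cong (_+ 1) (*-comm (n / 2) 2)) ⟩
    2 * (n / 2) + 1        ∎
    where open ≤-Reasoning
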